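{- Let $S$ be a finite set, let $S_1,\dots,S_n\subseteq S$, and let $k\ge 2$ be an integer. For a partition of $\{S_1,\dots,S_n\}$ into $k$ covers $c_1,\dots,c_k$, define its coverage as $\sum_{i=1}^k \left|\bigcup_{S_j\in c_i} S_j\right|$, and let $\mathrm{OPT}$ be the maximum coverage over all such partitions. Consider the (distributed) greedy algorithm: starting with all covers empty, for $j=1,2,\dots,n$ in order, assign $S_j$ to a cover $c_i$ that maximizes the number of elements of $S_j$ not contained in any subset already assigned to $c_i$ (ties broken arbitrarily). Then the coverage of the resulting partition is at least $\frac{1}{2}\mathrm{OPT}$.
   Context: This is the SET K-COVER problem: given $S$, the collection $\{S_j\}_{j=1}^n$ and $k$, find a partition of the subsets into $k$ covers maximizing $\sum_{i=1}^k |\bigcup_{S_j\in c_i} S_j|$. -}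

module Defs where

open import Data.Nat using (ℕ; _<_)
open import Data.Fin using (Fin; toℕ)
open import Data.Fin.Properties using (_≟_)
open import Data.Fin.Subset using (Subset; ⋃; _─_; ∣_∣)
open import Data.List using (List; filter; map; allFin)
open import Data.Nat.ListAction using (sum)
open import Data.Product using (_×_)
open import Relation.Binary.PropositionalEquality using (_≡_)
open import Relation.Nullary using (Dec)
open import Relation.Nullary.Decidable using (_×-dec_)
import Data.Nat.Properties as ℕP

-- A partition of the collection into k covers c_1..c_k is an assignment
-- Fin n → Fin k  (subset j goes to cover  a j; covers may be empty).

cover : ∀ {m n k} → (Fin n → Subset m) → (Fin n → Fin k) → Fin k → Subset m
cover {n = n} Ss a i = ⋃ (map Ss (filter (λ j → a j ≟ i) (allFin n)))

coverage : ∀ {m n k} → (Fin n → Subset m) → (Fin n → Fin k) → ℕ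
coverage {k = k} Ss a = sum (map (λ i → ∣ cover Ss a i ∣) (allFin k))

-- Cover i as it stands just before S_j is processed: union of the S_j'
-- with j' < j that were assigned to i.
coverBefore : ∀ {m n k} → (Fin n → Subset m) → (Fin n → Fin k) → Fin n → Fin k → Subset m
coverBefore {n = n} Ss a j i =
  ⋃ (map Ss (filter (λ j' → ℕP._<?_ (toℕ j') (toℕ j) ×-dec (a j' ≟ i)) (allFin n)))

gain : ∀ {m n k} → (Fin n → Subset m) → (Fin n → Fin k) → Fin n → Fin k → ℕ
gain Ss a j i = ∣ Ss j ─ coverBefore Ss a j i ∣

-- a is a possible output of the greedy algorithm (ties broken arbitrarily):
-- at every step j, the chosen cover a j maximizes the gain among all covers.
IsGreedy : ∀ {m n k} → (Fin n → Subset m) → (Fin n → Fin k) → Set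
IsGreedy {n = n} {k = k} Ss a = (j : Fin n) (i : Fin k) → gain Ss a j i Data.Nat.≤ gain Ss a j (a j)

-- Compare an arbitrary partition b with a greedy one a, one element x at a time. If x lies
-- in the cover b_i but not in the greedy cover a_i, then x ∈ S_j for some j with b j = i, and
-- x is not in the part of a_i built before step j; so the elements of b_i outside a_i number
-- at most Σ_{b j = i} gain j i, and gain j (b j) ≤ gain j (a j) by greediness. Hence
-- coverage b ≤ coverage a + Σ_j gain j (a j), and Σ_j gain j (a j) ≤ coverage a because an
-- element of a greedy cover is new to it only at the first set that brings it in.
module Submission where

open import Defs
open import Data.Bool using (Bool; true; false; _∧_; _∨_; not; T)
open import Data.Bool.Properties using (∧-assoc; ∧-identityʳ; ∧-zeroʳ; T-∧; T-∨)
open import Data.Empty using (⊥-elim)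
open import Data.Fin using (Fin; zero; suc; toℕ)
open import Data.Fin.Properties using (_≟_)
open import Data.Fin.Subset using (Subset; ⋃; _─_; ∣_∣)
open import Data.List using (filter; map; tabulate)
import Data.Nat.ListAction as List
open import Data.Nat using (ℕ; zero; suc; _+_; _*_; _≤_; _<ᵇ_; z≤n; s≤s)
import Data.Nat.Properties as ℕ
open import Algebra.Properties.CommutativeMonoid.Sum ℕ.+-0-commutativeMonoid
  using (sum; sum-syntax; sum-cong-≗; sum-replicate-zero; ∑-distrib-+; ∑-comm)
open import Data.Product using (proj₂)
import Data.Sum as Sum
open import Data.Unit using (tt)
open import Data.Vec using ([]; _∷_; lookup)
open import Data.Vec.Functional using (foldr)
open import Data.Vec.Properties using (lookup-zipWith; lookup-replicate)
open import Function using (_∘_; id; Equivalence)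
open import Relation.Binary.PropositionalEquality using (_≡_; refl; sym; trans; cong; cong₂)
open import Relation.Nullary using (does)
open import Relation.Nullary.Decidable using (_×-dec_)
open import Relation.Unary using (Decidable)

open ℕ.≤-Reasoning

⟦_⟧ : Bool → ℕ
⟦ true ⟧ = 1
⟦ false ⟧ = 0

⟦⟧≤1 : ∀ b → ⟦ b ⟧ ≤ 1
⟦⟧≤1 true = ℕ.≤-refl
⟦⟧≤1 false = z≤n

any : ∀ {n} → (Fin n → Bool) → Bool
any = foldr _∨_ false

any-cong : ∀ {n} {v w : Fin n → Bool} → (∀ j → v j ≡ w j) → any v ≡ any w
any-cong {zero} _ = refl
any-cong {suc n} v≗w = cong₂ _∨_ (v≗w zero) (any-cong (v≗w ∘ suc))

any-mono : ∀ {n} {v w : Fin n → Bool} → (∀ j → T (v j) → T (w j)) → T (any v) → T (any w)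
any-mono {zero} _ ()
any-mono {suc n} v⇒w =
  Equivalence.from T-∨ ∘ Sum.map (v⇒w zero) (any-mono (v⇒w ∘ suc)) ∘ Equivalence.to T-∨

∑-mono-≤ : ∀ {n} {f g : Fin n → ℕ} → (∀ i → f i ≤ g i) → sum f ≤ sum g
∑-mono-≤ {zero} _ = z≤n
∑-mono-≤ {suc n} f≤g = ℕ.+-mono-≤ (f≤g zero) (∑-mono-≤ (f≤g ∘ suc))

∑-select : ∀ {k} (c : Fin k) (φ : Fin k → Bool) → ∑[ i < k ] ⟦ does (c ≟ i) ∧ φ i ⟧ ≡ ⟦ φ c ⟧
∑-select {suc k} zero φ = trans (cong (⟦ φ zero ⟧ +_) (sum-replicate-zero k)) (ℕ.+-identityʳ _)
∑-select {suc k} (suc c) φ = ∑-select c (φ ∘ suc)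

⟦any⟧≤∑⟦⟧ : ∀ {n} (v : Fin n → Bool) → ⟦ any v ⟧ ≤ ∑[ j < n ] ⟦ v j ⟧
⟦any⟧≤∑⟦⟧ {zero} v = z≤n
⟦any⟧≤∑⟦⟧ {suc n} v with v zero
... | true = s≤s z≤n
... | false = ⟦any⟧≤∑⟦⟧ (v ∘ suc)

⟦any⟧≤⟦α⟧+∑ : ∀ {n} (v : Fin n → Bool) α → ⟦ any v ⟧ ≤ ⟦ α ⟧ + ∑[ j < n ] ⟦ v j ∧ not α ⟧
⟦any⟧≤⟦α⟧+∑ v true = ℕ.≤-trans (⟦⟧≤1 (any v)) (ℕ.m≤m+n 1 _)
⟦any⟧≤⟦α⟧+∑ v false =
  ℕ.≤-trans (⟦any⟧≤∑⟦⟧ v) (ℕ.≤-reflexive (sum-cong-≗ (λ j → cong ⟦_⟧ (sym (∧-identityʳ (v j))))))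

first-occurrences-≤ : ∀ {n} (u : Fin n → Bool) →
  ∑[ j < n ] ⟦ u j ∧ not (any (λ j′ → (toℕ j′ <ᵇ toℕ j) ∧ u j′)) ⟧ ≤ ⟦ any u ⟧
first-occurrences-≤ {zero} u = z≤n
first-occurrences-≤ {suc n} u = split (u zero)
  where
  before₀ : Bool
  before₀ = any (λ j′ → (toℕ j′ <ᵇ 0) ∧ u j′)

  later : Fin n → Bool
  later j = any (λ j′ → (toℕ j′ <ᵇ toℕ j) ∧ u (suc j′))

  split : ∀ b → ⟦ b ∧ not before₀ ⟧ + ∑[ j < n ] ⟦ u (suc j) ∧ not (b ∨ later j) ⟧
              ≤ ⟦ b ∨ any (u ∘ suc) ⟧
  split true = begin
    ⟦ not before₀ ⟧ + ∑[ j < n ] ⟦ u (suc j) ∧ false ⟧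
      ≡⟨ cong (⟦ not before₀ ⟧ +_)
           (trans (sum-cong-≗ (cong ⟦_⟧ ∘ ∧-zeroʳ ∘ u ∘ suc)) (sum-replicate-zero n)) ⟩
    ⟦ not before₀ ⟧ + 0
      ≤⟨ ℕ.+-monoˡ-≤ 0 (⟦⟧≤1 (not before₀)) ⟩
    1 ∎
  split false = first-occurrences-≤ (u ∘ suc)

⟦∧not⟧-antitone : ∀ s {α β} → (T β → T α) → ⟦ s ∧ not α ⟧ ≤ ⟦ s ∧ not β ⟧
⟦∧not⟧-antitone false _ = z≤n
⟦∧not⟧-antitone true {true} _ = z≤n
⟦∧not⟧-antitone true {false} {false} _ = ℕ.≤-refl
⟦∧not⟧-antitone true {false} {true} β⇒α = ⊥-elim (β⇒α tt)

-- The covers as seen by a single element x of the ground set, where s j says x ∈ S_j;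
-- fresh c j i says that x counts towards the gain of S_j for cover i.
module Membership {n k : ℕ} (s : Fin n → Bool) where

  inCover : (Fin n → Fin k) → Fin k → Fin n → Bool
  inCover c i j = does (c j ≟ i) ∧ s j

  covered : (Fin n → Fin k) → Fin k → Bool
  covered c i = any (inCover c i)

  coveredBefore : (Fin n → Fin k) → Fin n → Fin k → Bool
  coveredBefore c j i = any (λ j′ → (toℕ j′ <ᵇ toℕ j) ∧ inCover c i j′)

  fresh : (Fin n → Fin k) → Fin n → Fin k → Bool
  fresh c j i = s j ∧ not (coveredBefore c j i)

  coveredBefore⇒covered : ∀ c j i → T (coveredBefore c j i) → T (covered c i)
  coveredBefore⇒covered c j i =
    any-mono {w = inCover c i} (λ j′ → proj₂ ∘ Equivalence.to (T-∧ {toℕ j′ <ᵇ toℕ j}))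

  ∑covered-≤-∑covered+∑fresh : ∀ a b →
    ∑[ i < k ] ⟦ covered b i ⟧ ≤ ∑[ i < k ] ⟦ covered a i ⟧ + ∑[ j < n ] ⟦ fresh a j (b j) ⟧
  ∑covered-≤-∑covered+∑fresh a b = begin
    ∑[ i < k ] ⟦ covered b i ⟧
      ≤⟨ ∑-mono-≤ (λ i → ⟦any⟧≤⟦α⟧+∑ (inCover b i) (covered a i)) ⟩
    ∑[ i < k ] (⟦ covered a i ⟧ + ∑[ j < n ] ⟦ inCover b i j ∧ not (covered a i) ⟧)
      ≡⟨ ∑-distrib-+ (λ i → ⟦ covered a i ⟧) _ ⟩
    ∑A + ∑[ i < k ] ∑[ j < n ] ⟦ inCover b i j ∧ not (covered a i) ⟧
      ≡⟨ cong (∑A +_) (∑-comm (λ i j → ⟦ inCover b i j ∧ not (covered a i) ⟧)) ⟩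
    ∑A + ∑[ j < n ] ∑[ i < k ] ⟦ inCover b i j ∧ not (covered a i) ⟧
      ≡⟨ cong (∑A +_) (sum-cong-≗ λ j →
           trans (sum-cong-≗ λ i → cong ⟦_⟧ (∧-assoc (does (b j ≟ i)) (s j) (not (covered a i))))
                 (∑-select (b j) (λ i → s j ∧ not (covered a i)))) ⟩
    ∑A + ∑[ j < n ] ⟦ s j ∧ not (covered a (b j)) ⟧
      ≤⟨ ℕ.+-monoʳ-≤ ∑A (∑-mono-≤ λ j → ⟦∧not⟧-antitone (s j) (coveredBefore⇒covered a j (b j))) ⟩
    ∑A + ∑[ j < n ] ⟦ fresh a j (b j) ⟧ ∎
    where
    ∑A : ℕ
    ∑A = ∑[ i < k ] ⟦ covered a i ⟧

  ∑fresh-≤-∑covered : ∀ a → ∑[ j < n ] ⟦ fresh a j (a j) ⟧ ≤ ∑[ i < k ] ⟦ covered a i ⟧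
  ∑fresh-≤-∑covered a = begin
    ∑[ j < n ] ⟦ fresh a j (a j) ⟧
      ≡⟨ sum-cong-≗ (λ j → sym (∑-select (a j) (fresh a j))) ⟩
    ∑[ j < n ] ∑[ i < k ] ⟦ does (a j ≟ i) ∧ fresh a j i ⟧
      ≡⟨ ∑-comm (λ j i → ⟦ does (a j ≟ i) ∧ fresh a j i ⟧) ⟩
    ∑[ i < k ] ∑[ j < n ] ⟦ does (a j ≟ i) ∧ fresh a j i ⟧
      ≡⟨ sum-cong-≗ (λ i → sum-cong-≗ λ j → cong ⟦_⟧ (sym (∧-assoc (does (a j ≟ i)) (s j) _))) ⟩
    ∑[ i < k ] ∑[ j < n ] ⟦ inCover a i j ∧ not (coveredBefore a j i) ⟧
      ≤⟨ ∑-mono-≤ (λ i → first-occurrences-≤ (inCover a i)) ⟩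
    ∑[ i < k ] ⟦ covered a i ⟧ ∎

∣p∣≡∑⟦lookup⟧ : ∀ {m} (p : Subset m) → ∣ p ∣ ≡ ∑[ x < m ] ⟦ lookup p x ⟧
∣p∣≡∑⟦lookup⟧ [] = refl
∣p∣≡∑⟦lookup⟧ (true ∷ p) = cong suc (∣p∣≡∑⟦lookup⟧ p)
∣p∣≡∑⟦lookup⟧ (false ∷ p) = ∣p∣≡∑⟦lookup⟧ p

lookup-─ : ∀ {m} (p q : Subset m) x → lookup (p ─ q) x ≡ lookup p x ∧ not (lookup q x)
lookup-─ (b ∷ p) (true ∷ q) zero = sym (∧-zeroʳ b)
lookup-─ (b ∷ p) (false ∷ q) zero = sym (∧-identityʳ b)
lookup-─ (_ ∷ p) (_ ∷ q) (suc x) = lookup-─ p q x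

lookup-⋃-filter : ∀ {m n} {B : Set} (Ss : B → Subset m) {P : B → Set} (P? : Decidable P)
  (g : Fin n → B) x →
  lookup (⋃ (map Ss (filter P? (tabulate g)))) x ≡ any (λ j → does (P? (g j)) ∧ lookup (Ss (g j)) x)
lookup-⋃-filter {n = zero} Ss P? g x = lookup-replicate x false
lookup-⋃-filter {n = suc n} Ss P? g x with does (P? (g zero))
... | false = lookup-⋃-filter Ss P? (g ∘ suc) x
... | true = trans (lookup-zipWith _∨_ x (Ss (g zero)) _)
                   (cong (lookup (Ss (g zero)) x ∨_) (lookup-⋃-filter Ss P? (g ∘ suc) x))

sum-map-tabulate : ∀ {n} {B : Set} (f : B → ℕ) (g : Fin n → B) →
  List.sum (map f (tabulate g)) ≡ ∑[ i < n ] f (g i)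
sum-map-tabulate {zero} f g = refl
sum-map-tabulate {suc n} f g = cong (f (g zero) +_) (sum-map-tabulate f (g ∘ suc))

module _ {m n : ℕ} (Ss : Fin n → Subset m) where
  open Membership

  member : Fin m → Fin n → Bool
  member x j = lookup (Ss j) x

  coverage-pointwise : ∀ {k} (c : Fin n → Fin k) →
    coverage Ss c ≡ ∑[ x < m ] ∑[ i < k ] ⟦ covered (member x) c i ⟧
  coverage-pointwise {k} c = begin-equality
    coverage Ss c
      ≡⟨ sum-map-tabulate (λ i → ∣ cover Ss c i ∣) id ⟩
    ∑[ i < k ] ∣ cover Ss c i ∣
      ≡⟨ sum-cong-≗ (λ i → trans (∣p∣≡∑⟦lookup⟧ (cover Ss c i))
           (sum-cong-≗ λ x → cong ⟦_⟧ (lookup-⋃-filter Ss (λ j → c j ≟ i) id x))) ⟩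
    ∑[ i < k ] ∑[ x < m ] ⟦ covered (member x) c i ⟧
      ≡⟨ ∑-comm (λ i x → ⟦ covered (member x) c i ⟧) ⟩
    ∑[ x < m ] ∑[ i < k ] ⟦ covered (member x) c i ⟧ ∎

  gain-pointwise : ∀ {k} (c : Fin n → Fin k) j i →
    gain Ss c j i ≡ ∑[ x < m ] ⟦ fresh (member x) c j i ⟧
  gain-pointwise c j i = trans (∣p∣≡∑⟦lookup⟧ (Ss j ─ before)) (sum-cong-≗ λ x →
    cong ⟦_⟧ (trans (lookup-─ (Ss j) before x) (cong (λ b → member x j ∧ not b) (before-at x))))
    where
    before : Subset m
    before = coverBefore Ss c j i

    before-at : ∀ x → lookup before x ≡ coveredBefore (member x) c j i
    before-at x = trans
      (lookup-⋃-filter Ss (λ j′ → (toℕ j′ ℕ.<? toℕ j) ×-dec (c j′ ≟ i)) id x)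
      (any-cong λ j′ → ∧-assoc (toℕ j′ <ᵇ toℕ j) (does (c j′ ≟ i)) (member x j′))

  coverage-≤-coverage+∑gain : ∀ {k} (a b : Fin n → Fin k) →
    coverage Ss b ≤ coverage Ss a + ∑[ j < n ] gain Ss a j (b j)
  coverage-≤-coverage+∑gain {k} a b = begin
    coverage Ss b
      ≡⟨ coverage-pointwise b ⟩
    ∑[ x < m ] ∑[ i < k ] ⟦ covered (member x) b i ⟧
      ≤⟨ ∑-mono-≤ (λ x → ∑covered-≤-∑covered+∑fresh (member x) a b) ⟩
    ∑[ x < m ] (∑[ i < k ] ⟦ covered (member x) a i ⟧ + ∑[ j < n ] ⟦ fresh (member x) a j (b j) ⟧)
      ≡⟨ ∑-distrib-+ (λ x → ∑[ i < k ] ⟦ covered (member x) a i ⟧) _ ⟩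
    ∑[ x < m ] ∑[ i < k ] ⟦ covered (member x) a i ⟧
      + ∑[ x < m ] ∑[ j < n ] ⟦ fresh (member x) a j (b j) ⟧
      ≡⟨ cong₂ _+_ (sym (coverage-pointwise a))
                   (∑-comm (λ x j → ⟦ fresh (member x) a j (b j) ⟧)) ⟩
    coverage Ss a + ∑[ j < n ] ∑[ x < m ] ⟦ fresh (member x) a j (b j) ⟧
      ≡⟨ cong (coverage Ss a +_) (sum-cong-≗ λ j → sym (gain-pointwise a j (b j))) ⟩
    coverage Ss a + ∑[ j < n ] gain Ss a j (b j) ∎

  ∑gain-≤-coverage : ∀ {k} (a : Fin n → Fin k) → ∑[ j < n ] gain Ss a j (a j) ≤ coverage Ss a
  ∑gain-≤-coverage {k} a = begin
    ∑[ j < n ] gain Ss a j (a j)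
      ≡⟨ sum-cong-≗ (λ j → gain-pointwise a j (a j)) ⟩
    ∑[ j < n ] ∑[ x < m ] ⟦ fresh (member x) a j (a j) ⟧
      ≡⟨ ∑-comm (λ j x → ⟦ fresh (member x) a j (a j) ⟧) ⟩
    ∑[ x < m ] ∑[ j < n ] ⟦ fresh (member x) a j (a j) ⟧
      ≤⟨ ∑-mono-≤ (λ x → ∑fresh-≤-∑covered (member x) a) ⟩
    ∑[ x < m ] ∑[ i < k ] ⟦ covered (member x) a i ⟧
      ≡⟨ coverage-pointwise a ⟨
    coverage Ss a ∎

theorem2 : (m n k : ℕ) → 2 ≤ k → (Ss : Fin n → Subset m) → (a : Fin n → Fin k) →
    IsGreedy Ss a → (b : Fin n → Fin k) → coverage Ss b ≤ 2 * coverage Ss a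
-- The bound holds for every k.
theorem2 m n k _ Ss a greedy b = begin
  coverage Ss b
    ≤⟨ coverage-≤-coverage+∑gain Ss a b ⟩
  coverage Ss a + ∑[ j < n ] gain Ss a j (b j)
    ≤⟨ ℕ.+-monoʳ-≤ (coverage Ss a) (∑-mono-≤ λ j → greedy j (b j)) ⟩
  coverage Ss a + ∑[ j < n ] gain Ss a j (a j)
    ≤⟨ ℕ.+-monoʳ-≤ (coverage Ss a) (∑gain-≤-coverage Ss a) ⟩
  coverage Ss a + coverage Ss a
    ≡⟨ cong (coverage Ss a +_) (ℕ.+-identityʳ (coverage Ss a)) ⟨
  2 * coverage Ss a ∎
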